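{- Let $\mathbf{A}$ be a pointed lattice and $F$ a prime $\mathsf{1}$-filter of $\mathbf{A}$. Let $\Theta_{\mathrm{C}}(F):=\mathrm{Cg}^{\mathbf{A}}\{\langle f\wedge\mathsf{1},\mathsf{1}\rangle:f\in F\}\vee\mathrm{Cg}^{\mathbf{A}}\{\langle i\wedge\mathsf{1},i\rangle: i\notin F\}$. Then $\mathbf{A}/\Theta_{\mathrm{C}}(F)$ is conic, the positive kernel of $\Theta_{\mathrm{C}}(F)$ is $F$, and $\Theta_{\mathrm{C}}(F)\subseteq\phi$ for every congruence $\phi$ of $\mathbf{A}$ such that $\mathbf{A}/\phi$ is conic and the positive kernel of $\phi$ is $F$.
   Context: A pointed lattice is a lattice with a constant $\mathsf{1}$; it is conic if every element $x$ satisfies $x\leq\mathsf{1}$ or $\mathsf{1}\leq x$. A $\mathsf{1}$-filter is a lattice filter containing $\mathsf{1}$; it is prime if $a\vee b\in F$ implies $a\in F$ or $b\in F$. $\mathrm{Cg}^{\mathbf{A}}X$ is the congruence generated by $X$, and $\vee$ between congruences is the join in the congruence lattice. The positive kernel of a congruence $\theta$ is $\{a: a/\theta\geq\mathsf{1}/\theta\}$. -}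

module Defs where

open import Level using (Level; _⊔_) renaming (suc to lsuc)
open import Algebra.Lattice.Bundles using (Lattice)
open import Data.Product using (_×_; Σ; _,_)
open import Data.Sum using (_⊎_)
open import Relation.Nullary using (¬_)

record PointedLattice (c ℓ : Level) : Set (lsuc (c ⊔ ℓ)) where
  field
    lattice : Lattice c ℓ
  open Lattice lattice public
  field
    𝟏 : Carrier

module _ {c ℓ : Level} (A : PointedLattice c ℓ) where
  open PointedLattice A

  Subset : Set (lsuc (c ⊔ ℓ))
  Subset = Carrier → Set (c ⊔ ℓ)

  BinRel : Set (lsuc (c ⊔ ℓ))
  BinRel = Carrier → Carrier → Set (c ⊔ ℓ)

  _≼_ : Carrier → Carrier → Set ℓ
  a ≼ b = (a ∧ b) ≈ a

  record Is𝟏Filter (F : Subset) : Set (c ⊔ ℓ) where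
    field
      up      : ∀ {a b} → a ≼ b → F a → F b
      meet    : ∀ {a b} → F a → F b → F (a ∧ b)
      has-𝟏   : F 𝟏

  IsPrime : Subset → Set (c ⊔ ℓ)
  IsPrime F = ∀ {a b} → F (a ∨ b) → F a ⊎ F b

  record IsPrime𝟏Filter (F : Subset) : Set (c ⊔ ℓ) where
    field
      is𝟏Filter : Is𝟏Filter F
      prime     : IsPrime F

  record IsCongruence (θ : BinRel) : Set (c ⊔ ℓ) where
    field
      ≈⇒θ   : ∀ {a b} → a ≈ b → θ a b
      θ-sym   : ∀ {a b} → θ a b → θ b a
      θ-trans : ∀ {a b d} → θ a b → θ b d → θ a d
      ∨-comp  : ∀ {a b a' b'} → θ a a' → θ b b' → θ (a ∨ b) (a' ∨ b')
      ∧-comp  : ∀ {a b a' b'} → θ a a' → θ b b' → θ (a ∧ b) (a' ∧ b')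

  data Cg (X : BinRel) : BinRel where
    gen     : ∀ {a b} → X a b → Cg X a b
    ≈-incl  : ∀ {a b} → a ≈ b → Cg X a b
    cg-sym  : ∀ {a b} → Cg X a b → Cg X b a
    cg-trans : ∀ {a b d} → Cg X a b → Cg X b d → Cg X a d
    cg-∨    : ∀ {a b a' b'} → Cg X a a' → Cg X b b' → Cg X (a ∨ b) (a' ∨ b')
    cg-∧    : ∀ {a b a' b'} → Cg X a a' → Cg X b b' → Cg X (a ∧ b) (a' ∧ b')

  _∨Con_ : BinRel → BinRel → BinRel
  (θ ∨Con ψ) = Cg (λ a b → θ a b ⊎ ψ a b)

  -- order in the quotient A/θ:  a/θ ≤ b/θ  iff  (a ∧ b) θ a
  _≤[_]_ : Carrier → BinRel → Carrier → Set (c ⊔ ℓ)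
  a ≤[ θ ] b = θ (a ∧ b) a

  QuotientConic : BinRel → Set (c ⊔ ℓ)
  QuotientConic θ = ∀ x → (x ≤[ θ ] 𝟏) ⊎ (𝟏 ≤[ θ ] x)

  PosKernel : BinRel → Subset
  PosKernel θ a = 𝟏 ≤[ θ ] a

  _≐_ : Subset → Subset → Set (c ⊔ ℓ)
  F ≐ G = (∀ a → F a → G a) × (∀ a → G a → F a)

  _⊆Rel_ : BinRel → BinRel → Set (c ⊔ ℓ)
  θ ⊆Rel φ = ∀ a b → θ a b → φ a b

  ΘC : Subset → BinRel
  ΘC F = Cg (λ x y → Σ Carrier λ f → F f × (x ≡ (f ∧ 𝟏)) × (y ≡ 𝟏))
         ∨Con
         Cg (λ x y → Σ Carrier λ i → (¬ F i) × (x ≡ (i ∧ 𝟏)) × (y ≡ i))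
    where open import Relation.Binary.PropositionalEquality using (_≡_)

-- The first family puts every element
-- of F above 𝟏 and the second puts every element outside F below 𝟏, so
-- (classically) the quotient is conic with positive kernel containing F.
-- Conversely, since F is a prime filter, "a ∈ F ⇔ b ∈ F" is a congruence
-- containing both families, hence Θ_C(F); so 𝟏 ∧ a Θ_C(F) 𝟏 forces a ∈ F.
-- Finally a congruence φ with conic quotient and positive kernel F contains
-- both families: f ∧ 𝟏 φ 𝟏 says f/φ ≥ 𝟏/φ, and for i ∉ F conicity leaves only
-- i/φ ≤ 𝟏/φ, i.e. i ∧ 𝟏 φ i.
{-# OPTIONS --safe #-}
module Submission where

open import Defs
open import Level using (Level; _⊔_)
open import Data.Empty using (⊥-elim)
open import Data.Product using (_×_; _,_)
open import Data.Sum using (inj₁; inj₂; [_,_])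
open import Function.Bundles using (_⇔_; mk⇔; Equivalence)
open Equivalence using (to; from)
open import Function.Properties.Equivalence using (⇔-isEquivalence)
open import Relation.Binary.Structures using (IsEquivalence)
open import Relation.Nullary using (¬_; yes; no)
open import Relation.Binary.PropositionalEquality using () renaming (refl to ≡-refl)
open import Axiom.ExcludedMiddle using (ExcludedMiddle)
import Algebra.Lattice.Properties.Lattice as LatticeProperties
import Relation.Binary.Reasoning.Setoid as SetoidReasoning

module _ {c ℓ : Level} (A : PointedLattice c ℓ) where
  open PointedLattice A
  open LatticeProperties lattice using (∧-idem)
  open SetoidReasoning setoid

  Cg-least : ∀ {X φ : BinRel A} → IsCongruence A φ →
             (∀ {a b} → X a b → φ a b) → ∀ {a b} → Cg A X a b → φ a b
  Cg-least {X} {φ} φ-cong X⊆φ = go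
    where
      open IsCongruence φ-cong

      go : ∀ {a b} → Cg A X a b → φ a b
      go (gen x)        = X⊆φ x
      go (≈-incl a≈b)   = ≈⇒θ a≈b
      go (cg-sym p)     = θ-sym (go p)
      go (cg-trans p q) = θ-trans (go p) (go q)
      go (cg-∨ p q)     = ∨-comp (go p) (go q)
      go (cg-∧ p q)     = ∧-comp (go p) (go q)

  ≈⇒≼ : ∀ {a b} → a ≈ b → _≼_ A a b
  ≈⇒≼ {a} {b} a≈b = begin
    a ∧ b ≈⟨ ∧-congˡ (sym a≈b) ⟩
    a ∧ a ≈⟨ ∧-idem a ⟩
    a     ∎

  x∧y≼x : ∀ x y → _≼_ A (x ∧ y) x
  x∧y≼x x y = begin
    (x ∧ y) ∧ x ≈⟨ ∧-assoc x y x ⟩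
    x ∧ (y ∧ x) ≈⟨ ∧-congˡ (∧-comm y x) ⟩
    x ∧ (x ∧ y) ≈⟨ sym (∧-assoc x x y) ⟩
    (x ∧ x) ∧ y ≈⟨ ∧-congʳ (∧-idem x) ⟩
    x ∧ y       ∎

  module 𝟏Filter {F : Subset A} (F-filter : Is𝟏Filter A F) where
    open Is𝟏Filter F-filter public

    resp-≈ : ∀ {a b} → a ≈ b → F a → F b
    resp-≈ a≈b = up (≈⇒≼ a≈b)

    ∧-elimˡ : ∀ {a b} → F (a ∧ b) → F a
    ∧-elimˡ {a} {b} = up (x∧y≼x a b)

    ∧-elimʳ : ∀ {a b} → F (a ∧ b) → F b
    ∧-elimʳ {a} {b} a∧b∈F = ∧-elimˡ (resp-≈ (∧-comm a b) a∧b∈F)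

    ∨-introˡ : ∀ {a b} → F a → F (a ∨ b)
    ∨-introˡ {a} {b} = up (∧-absorbs-∨ a b)

    ∨-introʳ : ∀ {a b} → F b → F (a ∨ b)
    ∨-introʳ {a} {b} b∈F = resp-≈ (∨-comm b a) (∨-introˡ b∈F)

  ΘC-least : ∀ {F : Subset A} {φ : BinRel A} → IsCongruence A φ →
             (∀ f → F f → φ (f ∧ 𝟏) 𝟏) → (∀ i → ¬ F i → φ (i ∧ 𝟏) i) →
             ∀ {a b} → ΘC A F a b → φ a b
  ΘC-least φ-cong member nonmember = Cg-least φ-cong
    [ Cg-least φ-cong (λ { (f , f∈F , ≡-refl , ≡-refl) → member f f∈F })
    , Cg-least φ-cong (λ { (i , i∉F , ≡-refl , ≡-refl) → nonmember i i∉F })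
    ]

  𝟏≤-of-member : ∀ {F : Subset A} {f} → F f → PosKernel A (ΘC A F) f
  𝟏≤-of-member {f = f} f∈F =
    cg-trans (≈-incl (∧-comm 𝟏 f)) (gen (inj₁ (gen (f , f∈F , ≡-refl , ≡-refl))))

  ≤𝟏-of-nonmember : ∀ {F : Subset A} {i} → ¬ F i → _≤[_]_ A i (ΘC A F) 𝟏
  ≤𝟏-of-nonmember {i = i} i∉F = gen (inj₂ (gen (i , i∉F , ≡-refl , ≡-refl)))

  SameMembership : Subset A → BinRel A
  SameMembership F a b = F a ⇔ F b

  SameMembership-isCongruence : ∀ {F : Subset A} → IsPrime𝟏Filter A F →
                                IsCongruence A (SameMembership F)
  SameMembership-isCongruence {F} F-prime = record
    { ≈⇒θ     = λ a≈b → mk⇔ (resp-≈ a≈b) (resp-≈ (sym a≈b))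
    ; θ-sym   = ⇔-sym
    ; θ-trans = ⇔-trans
    ; ∨-comp  = λ a~a' b~b' →
        mk⇔ (∨-transport a~a' b~b') (∨-transport (⇔-sym a~a') (⇔-sym b~b'))
    ; ∧-comp  = λ a~a' b~b' →
        mk⇔ (∧-transport a~a' b~b') (∧-transport (⇔-sym a~a') (⇔-sym b~b'))
    }
    where
      open IsPrime𝟏Filter F-prime
      open 𝟏Filter is𝟏Filter
      open IsEquivalence ⇔-isEquivalence using () renaming (sym to ⇔-sym; trans to ⇔-trans)

      ∨-transport : ∀ {a b a' b'} → F a ⇔ F a' → F b ⇔ F b' → F (a ∨ b) → F (a' ∨ b')
      ∨-transport a~a' b~b' a∨b∈F =
        [ (λ a∈F → ∨-introˡ (to a~a' a∈F)) , (λ b∈F → ∨-introʳ (to b~b' b∈F)) ]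
          (prime a∨b∈F)

      ∧-transport : ∀ {a b a' b'} → F a ⇔ F a' → F b ⇔ F b' → F (a ∧ b) → F (a' ∧ b')
      ∧-transport a~a' b~b' a∧b∈F = meet (to a~a' (∧-elimˡ a∧b∈F)) (to b~b' (∧-elimʳ a∧b∈F))

  ΘC⊆SameMembership : ∀ {F : Subset A} → IsPrime𝟏Filter A F →
                      ∀ {a b} → ΘC A F a b → SameMembership F a b
  ΘC⊆SameMembership F-prime = ΘC-least (SameMembership-isCongruence F-prime)
    (λ f f∈F → mk⇔ (λ _ → has-𝟏) (λ _ → meet f∈F has-𝟏))
    (λ i i∉F → mk⇔ ∧-elimˡ (λ i∈F → ⊥-elim (i∉F i∈F)))
    where
      open 𝟏Filter (IsPrime𝟏Filter.is𝟏Filter F-prime)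

  PosKernel-ΘC⊆ : ∀ {F : Subset A} → IsPrime𝟏Filter A F →
                  ∀ a → PosKernel A (ΘC A F) a → F a
  PosKernel-ΘC⊆ F-prime a 𝟏≤a =
    ∧-elimʳ (from (ΘC⊆SameMembership F-prime 𝟏≤a) has-𝟏)
    where
      open 𝟏Filter (IsPrime𝟏Filter.is𝟏Filter F-prime)

  ΘC-conic : ∀ {F : Subset A} → ExcludedMiddle (c ⊔ ℓ) → QuotientConic A (ΘC A F)
  ΘC-conic {F} em x with em {F x}
  ... | yes x∈F = inj₂ (𝟏≤-of-member x∈F)
  ... | no  x∉F = inj₁ (≤𝟏-of-nonmember x∉F)

  ΘC-minimal : ∀ {F : Subset A} (φ : BinRel A) → IsCongruence A φ →
               QuotientConic A φ → _≐_ A (PosKernel A φ) F → _⊆Rel_ A (ΘC A F) φ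
  ΘC-minimal φ φ-cong φ-conic (kernel⊆F , F⊆kernel) _ _ = ΘC-least φ-cong
    (λ f f∈F → IsCongruence.θ-trans φ-cong
                 (IsCongruence.≈⇒θ φ-cong (∧-comm f 𝟏)) (F⊆kernel f f∈F))
    (λ i i∉F → [ (λ i≤𝟏 → i≤𝟏) , (λ 𝟏≤i → ⊥-elim (i∉F (kernel⊆F i 𝟏≤i))) ] (φ-conic i))

lemma2p10 : {c ℓ : Level} → ExcludedMiddle (c ⊔ ℓ) →
    (A : PointedLattice c ℓ) → (F : Subset A) → IsPrime𝟏Filter A F →
    QuotientConic A (ΘC A F)
    × _≐_ A (PosKernel A (ΘC A F)) F
    × (∀ (φ : BinRel A) → IsCongruence A φ → QuotientConic A φ →
         _≐_ A (PosKernel A φ) F → _⊆Rel_ A (ΘC A F) φ)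
lemma2p10 em A F F-prime =
    ΘC-conic A em
  , (PosKernel-ΘC⊆ A F-prime , λ _ → 𝟏≤-of-member A)
  , ΘC-minimal A
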